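{- Consider the dynamic program for Min-Max Disjoint Paths on a series-parallel digraph $D$ with $k$ paths in which, for each table cell, among all candidate path profiles the one with $k'$ paths of lengths $p_1\ge\dots\ge p_{k'}$ minimizing $\max_{i\in\{1,\dots,k'-1\}}\big\{\frac1i\sum_{j=1}^ip_j-p_{i+1}\big\}$ is selected. Then the objective value $\mathrm{DP}$ of the computed solution satisfies $\mathrm{DP}\le H_k\cdot\mathrm{OPT}$, where $\mathrm{OPT}$ is the optimal objective value.
   Context: Min-Max Disjoint Paths: given a digraph $D$ with source $s$, sink $t$, travel times $\tau:A\to\mathbb{Z}_{\ge0}$ and integer $k$, find $k$ pairwise arc-disjoint $s$-$t$-paths (a path profile) minimizing the maximum path length. $D$ is series-parallel with a fixed binary decomposition tree (leaves = arcs, internal vertices = series or parallel compositions of their two children; series composition identifies the sink of the first with the source of the second, parallel identifies sources and sinks). The dynamic program has a cell $(D',k',\theta')$ for each subgraph $D'$ corresponding to a tree vertex, each $k'\in\{0,\dots,k\}$, and each $\theta'$ in the set $\Theta$ of possible total lengths; a cell stores at most one path profile of $D'$ with $k'$ paths of total length $\theta'$ (sum of path lengths in $D'$). For a single arc $a$: $(D',1,\tau_a)$ stores $\{(a)\}$, $(D',0,0)$ stores the empty profile, other cells are empty. For $D'\circ D''$, the candidates of cell $(D'\circ D'',\tilde k,\tilde\theta)$ are the greedy compositions of the profiles stored in $(D',k',\theta')$ and $(D'',k'',\theta'')$ over all $\theta'+\theta''=\tilde\theta$ with $\tilde k=k'+k''$ (parallel) or $\tilde k=k'=k''$ (series); greedy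 series composition pairs the longest path of the first profile with the shortest of the second, the second-longest with the second-shortest, etc.; greedy parallel composition takes the union. One candidate is stored according to the selection rule. Finally, among the profiles stored in cells $(D,k,\theta)$, $\theta\in\Theta$, the one with smallest maximum path length is output. $H_k=\sum_{j=1}^k\frac1j$. -}

module Defs where

open import Data.Nat as ℕ using (ℕ; zero; suc; _+_; _≥_)
open import Data.Nat.Properties using (≤-decTotalOrder)
open import Data.Integer using (+_)
open import Data.Rational as Q using (ℚ; 0ℚ; _/_; _-_; _⊔_)
open import Data.List using (List; []; _∷_; map; zipWith; _++_; reverse; length; foldr)
open import Data.List.Relation.Binary.Permutation.Propositional using (_↭_)
open import Data.List.Relation.Unary.Linked using (Linked)
open import Data.List.Relation.Unary.AllPairs using (AllPairs)
open import Data.Maybe using (Maybe; just; nothing)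
open import Data.Product using (Σ; ∃; _×_; _,_)
open import Data.Unit using (⊤)
open import Data.Empty using (⊥)
open import Relation.Binary.PropositionalEquality using (_≡_)
open import Relation.Nullary using (¬_; yes; no)
open import Data.List.Sort ≤-decTotalOrder using (sort)

-- Series-parallel digraphs given by their binary decomposition tree.
-- Leaves are arcs (carrying their travel time), internal vertices are
-- series / parallel compositions of their two children.

data SP : Set where
  arc : (τ : ℕ) → SP
  ser : SP → SP → SP
  par : SP → SP → SP

-- s-t-paths of the series-parallel digraph described by a tree.
-- (In a series composition every s-t-path passes through the identified
-- vertex, so it is an s-t-path of the first part followed by one of the
-- second part; in a parallel composition it lies entirely in one part.)
data Path : SP → Set where
  edge : ∀ {τ} → Path (arc τ)
  seq  : ∀ {A B} → Path A → Path B → Path (ser A B)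
  inl  : ∀ {A B} → Path A → Path (par A B)
  inr  : ∀ {A B} → Path B → Path (par A B)

len : ∀ {T} → Path T → ℕ
len {arc τ} edge = τ
len (seq p q) = len p + len q
len (inl p) = len p
len (inr p) = len p

Disj : ∀ {T} → Path T → Path T → Set
Disj edge edge = ⊥
Disj (seq p q) (seq p′ q′) = Disj p p′ × Disj q q′
Disj (inl p) (inl p′) = Disj p p′
Disj (inl p) (inr q) = ⊤
Disj (inr q) (inl p) = ⊤
Disj (inr q) (inr q′) = Disj q q′

-- a path profile is a (multi)set of paths, represented as a list
Profile : SP → Set
Profile T = List (Path T)

Feasible : ∀ {T} → ℕ → Profile T → Set
Feasible k P = length P ≡ k × AllPairs Disj P

maxLen : ∀ {T} → Profile T → ℕ
maxLen P = foldr ℕ._⊔_ 0 (map len P)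

totLen : ∀ {T} → Profile T → ℕ
totLen P = foldr _+_ 0 (map len P)

-- The maximum over the empty index set (k' ≤ 1) is represented by
-- `nothing` (= −∞).

sortDesc : List ℕ → List ℕ
sortDesc xs = reverse (sort xs)

-- go n s rest : the first (suc n) sorted lengths have been read, with sum s
scoreGo : ℕ → ℕ → List ℕ → List ℚ
scoreGo n s [] = []
scoreGo n s (q ∷ rest) = ((+ s) / suc n - (+ q) / 1) ∷ scoreGo (suc n) (s + q) rest

scoreTerms : List ℕ → List ℚ
scoreTerms [] = []
scoreTerms (p ∷ ps) = scoreGo 0 p ps

maxQ : List ℚ → Maybe ℚ
maxQ [] = nothing
maxQ (x ∷ xs) with maxQ xs
... | nothing = just x
... | just y  = just (x ⊔ y)

score : ∀ {T} → Profile T → Maybe ℚ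
score P = maxQ (scoreTerms (sortDesc (map len P)))

_≤S_ : Maybe ℚ → Maybe ℚ → Set
nothing ≤S _ = ⊤
just x ≤S nothing = ⊥
just x ≤S just y = x Q.≤ y

GreedySer : ∀ {A B} → Profile A → Profile B → Profile (ser A B) → Set
GreedySer {A} {B} P Q R =
  Σ (Profile A) λ P′ → Σ (Profile B) λ Q′ →
    P′ ↭ P × Q′ ↭ Q × length P′ ≡ length Q′ ×
    Linked _≥_ (map len P′) × Linked ℕ._≤_ (map len Q′) ×
    R ≡ zipWith seq P′ Q′

greedyPar : ∀ {A B} → Profile A → Profile B → Profile (par A B)
greedyPar P Q = map inl P ++ map inr Q

-- DP tables: cell (k', θ') stores at most one profile.
-- (Cells are provided for all k', θ' ∈ ℕ; cells with k' > k or θ' outside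
-- the set of achievable total lengths do not influence the cells that
-- matter, and those outside are empty anyway.)

Table : SP → Set
Table T = ℕ → ℕ → Maybe (Profile T)

leafTable : (τ : ℕ) → Table (arc τ)
leafTable τ 0 0 = just []
leafTable τ 1 θ with θ ℕ.≟ τ
... | yes _ = just (edge ∷ [])
... | no  _ = nothing
leafTable τ _ _ = nothing

CandSer : ∀ {A B} → Table A → Table B → ℕ → ℕ → Profile (ser A B) → Set
CandSer {A} {B} t₁ t₂ k θ R =
  Σ ℕ λ θ₁ → Σ ℕ λ θ₂ → Σ (Profile A) λ P → Σ (Profile B) λ Q →
    θ₁ + θ₂ ≡ θ × t₁ k θ₁ ≡ just P × t₂ k θ₂ ≡ just Q × GreedySer P Q R

CandPar : ∀ {A B} → Table A → Table B → ℕ → ℕ → Profile (par A B) → Set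
CandPar {A} {B} t₁ t₂ k θ R =
  Σ ℕ λ k₁ → Σ ℕ λ k₂ → Σ ℕ λ θ₁ → Σ ℕ λ θ₂ →
  Σ (Profile A) λ P → Σ (Profile B) λ Q →
    k₁ + k₂ ≡ k × θ₁ + θ₂ ≡ θ × t₁ k₁ θ₁ ≡ just P × t₂ k₂ θ₂ ≡ just Q ×
    R ≡ greedyPar P Q

Selects : ∀ {T} → (ℕ → ℕ → Profile T → Set) → Table T → Set
Selects {T} Cand t =
  ∀ k θ →
    (t k θ ≡ nothing → ∀ R → ¬ Cand k θ R) ×
    (∀ R → t k θ ≡ just R →
       Cand k θ R × (∀ R′ → Cand k θ R′ → score R ≤S score R′))

-- Run T t : t is a table that the dynamic program (with the above
-- selection rule) may compute for the subgraph given by T.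
data Run : (T : SP) → Table T → Set where
  leaf : ∀ τ → Run (arc τ) (leafTable τ)
  runSer : ∀ {A B t₁ t₂} (t : Table (ser A B)) →
           Run A t₁ → Run B t₂ → Selects (CandSer t₁ t₂) t → Run (ser A B) t
  runPar : ∀ {A B t₁ t₂} (t : Table (par A B)) →
           Run A t₁ → Run B t₂ → Selects (CandPar t₁ t₂) t → Run (par A B) t

H : ℕ → ℚ
H zero = 0ℚ
H (suc n) = H n Q.+ (+ 1) / suc n

toℚ : ℕ → ℚ
toℚ n = (+ n) / 1

-- Call a list of path lengths c-balanced if for every threshold x that some entry does not
-- exceed, the entries above x have mean at most x + c. For a decreasing list this says exactly
-- that the selection score is at most c, but balance does not depend on the order of the
-- entries. It survives parallel composition (union) when both parts have mean at most c, and
-- greedy series composition (longest with shortest). So, by induction over the decomposition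
-- tree, the cell (|Q|, total length of Q) of a feasible profile Q has a (maxLen Q)-balanced
-- candidate, and the selection rule then keeps the stored profile balanced as well; its mean
-- is at most maxLen Q because its total length is that of Q. Finally, for a decreasing
-- M-balanced list p₁ ≥ … ≥ p_k of mean at most M the prefix averages A_m = (p₁ + … + p_m) / m
-- satisfy A_m ≤ A_{m+1} + M / (m + 1), hence p₁ = A₁ ≤ A_k + (H_k - 1) M ≤ H_k M.

module Submission where

open import Defs
open import Data.Nat using (ℕ; _≤_)
open import Data.Rational as Q using ()
open import Data.Maybe using (just)
open import Data.Product using (Σ; _×_)
open import Relation.Binary.PropositionalEquality using (_≡_)

open import Level using (0ℓ)
open import Data.Nat.Properties
open import Algebra.Properties.CommutativeSemigroup +-commutativeSemigroup
  using (interchange; x∙yz≈y∙xz) renaming (xy∙z≈xz∙y to +-right-comm)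
open import Algebra.Properties.CommutativeSemigroup *-commutativeSemigroup
  using () renaming (x∙yz≈y∙xz to *-left-comm)
open import Data.Empty using (⊥-elim)
open import Data.Integer as ℤ using (+_)
import Data.Integer.Properties as ℤ
open import Data.List
  using (List; []; _∷_; _++_; [_]; _∷ʳ_; length; map; foldr; filter; reverse; zipWith; upTo)
open import Data.List.Extrema.Nat using (argmin; f[argmin]≤f[xs]; f[argmin]≤f[⊤])
open import Data.List.Membership.Propositional.Properties using (∈-upTo⁺)
open import Data.List.Properties
  using ( length-map; length-++; length-zipWith; map-++; map-∘; map-zipWith; zipWith-map
        ; ++-identityʳ; ∷ʳ-++; unfold-reverse
        ; filter-++; filter-all; filter-none; filter-accept; filter-reject )
open import Data.List.Relation.Binary.Permutation.Propositional
  using (_↭_; ↭-reflexive; ↭-refl; ↭-prep; ↭-trans; ↭-sym)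
open import Data.List.Relation.Binary.Permutation.Propositional.Properties
  using (↭-length; ↭-empty-inv; ↭-reverse; shift; filter-↭; All-resp-↭; Any-resp-↭)
  renaming (map⁺ to ↭-map⁺)
open import Data.List.Relation.Unary.All as All using (All; []; _∷_)
open import Data.List.Relation.Unary.All.Properties
  using (all-filter; filter⁺; ¬Any⇒All¬; ++⁻ʳ) renaming (map⁺ to All-map⁺; map⁻ to All-map⁻)
open import Data.List.Relation.Unary.AllPairs as AllPairs using (AllPairs; []; _∷_)
open import Data.List.Relation.Unary.AllPairs.Properties
  using () renaming (map⁺ to AllPairs-map⁺; ++⁺ to AllPairs-++⁺)
open import Data.List.Relation.Unary.Any using (Any; here; there; any?)
open import Data.List.Relation.Unary.Any.Properties using (++⁺ʳ)
open import Data.List.Relation.Unary.Linked.Properties using (Linked⇒AllPairs) renaming (map⁺ to Linked-map⁺)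
import Data.List.Sort as Sort
open import Data.List.Sort ≤-decTotalOrder using (sort; sort-↭; sort-↗)
open import Data.Maybe using (Maybe; nothing; maybe)
open import Data.Nat as ℕ using (zero; suc; _+_; _*_; _<_; _≥_; _⊓_; _⊔_; z≤n; s≤s; _<?_; _≤?_)
open import Data.Nat.ListAction using (sum)
open import Data.Nat.ListAction.Properties using (sum-++; sum-↭)
open import Data.Nat.Tactic.RingSolver using (solve-∀)
open import Data.Product using (_,_; proj₁; proj₂)
open import Data.Rational using (ℚ; _/_; 0ℚ; 1ℚ)
import Data.Rational.Properties as Q
open import Data.Rational.Solver using (module +-*-Solver)
open import Data.Rational.Unnormalised as ℚᵘ using (mkℚᵘ; *≡*; *≤*) renaming (_≃_ to _≃ᵘ_)
import Data.Rational.Unnormalised.Properties as ℚᵘ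
open import Data.Unit using (⊤; tt)
open import Function.Base using (flip; case_of_)
open import Function.Bundles using (_⇔_; mk⇔; Equivalence)
open import Function.Properties.Equivalence using () renaming (sym to ⇔-sym)
open import Function.Related.Propositional using (module EquationalReasoning)
open import Relation.Binary.PropositionalEquality
  using (refl; sym; trans; cong; cong₂; subst; subst₂; module ≡-Reasoning)
import Relation.Binary.Construct.Flip.EqAndOrd as Flip
import Relation.Binary.Construct.On as On
open import Relation.Nullary using (¬_; Dec; yes; no)
open import Relation.Unary using (Pred; Decidable)
open import Relation.Unary.Properties using (∁?)

sum-zipWith-+ : ∀ xs ys → length xs ≡ length ys → sum (zipWith _+_ xs ys) ≡ sum xs + sum ys
sum-zipWith-+ []       []       _  = refl
sum-zipWith-+ (x ∷ xs) (y ∷ ys) eq = begin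
  (x + y) + sum (zipWith _+_ xs ys) ≡⟨ cong (λ s → (x + y) + s) (sum-zipWith-+ xs ys (suc-injective eq)) ⟩
  (x + y) + (sum xs + sum ys)       ≡⟨ interchange x y (sum xs) (sum ys) ⟩
  (x + sum xs) + (y + sum ys)       ∎
  where open ≡-Reasoning

length-zipWith-≡ : ∀ {A B C : Set} (f : A → B → C) xs ys → length xs ≡ length ys →
  length (zipWith f xs ys) ≡ length xs
length-zipWith-≡ f xs ys eq =
  trans (length-zipWith f xs ys) (trans (cong (length xs ⊓_) (sym eq)) (⊓-idem _))

zipWith-∷ʳ-++ : ∀ {A B C : Set} (f : A → B → C) xs ys {x y zs} → length xs ≡ length ys →
  zipWith f (xs ∷ʳ x) (ys ∷ʳ y) ++ zs ≡ zipWith f xs ys ++ f x y ∷ zs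
zipWith-∷ʳ-++ f []       []       _  = refl
zipWith-∷ʳ-++ f (x ∷ xs) (y ∷ ys) eq = cong (f x y ∷_) (zipWith-∷ʳ-++ f xs ys (suc-injective eq))

AllPairs-++⁻ : ∀ {A : Set} {R : A → A → Set} us {vs} → AllPairs R (us ++ vs) →
  All (λ u → All (R u) vs) us × AllPairs R vs
AllPairs-++⁻ []       h          = [] , h
AllPairs-++⁻ (u ∷ us) (hu ∷ hus) with AllPairs-++⁻ us hus
... | us-vs , vs-ok = ++⁻ʳ us hu ∷ us-vs , vs-ok

AllPairs-reverse : ∀ {A : Set} {R : A → A → Set} {xs} → AllPairs R xs → AllPairs (flip R) (reverse xs)
AllPairs-reverse []                      = []
AllPairs-reverse {xs = x ∷ xs} (hx ∷ hs) = subst (AllPairs _) (sym (unfold-reverse x xs))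
  (AllPairs-++⁺ (AllPairs-reverse hs) ([] ∷ [])
    (All.map (_∷ []) (All-resp-↭ (↭-sym (↭-reverse xs)) hx)))

⊔-lub-foldr : ∀ {y xs} → All (_≤ y) xs → foldr ℕ._⊔_ 0 xs ≤ y
⊔-lub-foldr []       = z≤n
⊔-lub-foldr (h ∷ hs) = ⊔-lub h (⊔-lub-foldr hs)

≤-foldr-⊔ : ∀ xs → All (_≤ foldr ℕ._⊔_ 0 xs) xs
≤-foldr-⊔ []       = []
≤-foldr-⊔ (x ∷ xs) = m≤m⊔n x _ ∷ All.map (λ y≤ → ≤-trans y≤ (m≤n⊔m x _)) (≤-foldr-⊔ xs)

module _ {A : Set} {P : Pred A 0ℓ} (P? : Decidable P) where

  filter-++-reject-↭ : ∀ xs → filter P? xs ++ filter (∁? P?) xs ↭ xs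
  filter-++-reject-↭ []       = ↭-refl
  filter-++-reject-↭ (x ∷ xs) = by-cases (P? x)
    where
    by-cases : Dec (P x) → filter P? (x ∷ xs) ++ filter (∁? P?) (x ∷ xs) ↭ x ∷ xs
    by-cases (yes px) = ↭-trans
      (↭-reflexive (cong₂ _++_ (filter-accept P? px) (filter-reject (∁? P?) (λ ¬px → ¬px px))))
      (↭-prep x (filter-++-reject-↭ xs))
    by-cases (no ¬px) = ↭-trans
      (↭-reflexive (cong₂ _++_ (filter-reject P? ¬px) (filter-accept (∁? P?) ¬px)))
      (↭-trans (shift x (filter P? xs) (filter (∁? P?) xs)) (↭-prep x (filter-++-reject-↭ xs)))

MeanAtMost : ℕ → List ℕ → Set
MeanAtMost a xs = sum xs ≤ length xs * a

MeanAtMost-mono : ∀ {a b} xs → a ≤ b → MeanAtMost a xs → MeanAtMost b xs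
MeanAtMost-mono xs a≤b h = ≤-trans h (*-monoʳ-≤ (length xs) a≤b)

MeanAtMost-++ : ∀ {a} xs ys → MeanAtMost a xs → MeanAtMost a ys → MeanAtMost a (xs ++ ys)
MeanAtMost-++ {a} xs ys hx hy = begin
  sum (xs ++ ys)                   ≡⟨ sum-++ xs ys ⟩
  sum xs + sum ys                  ≤⟨ +-mono-≤ hx hy ⟩
  length xs * a + length ys * a    ≡⟨ *-distribʳ-+ a (length xs) (length ys) ⟨
  (length xs + length ys) * a      ≡⟨ cong (_* a) (length-++ xs) ⟨
  length (xs ++ ys) * a            ∎
  where open ≤-Reasoning

All⇒MeanAtMost : ∀ {a xs} → All (_≤ a) xs → MeanAtMost a xs
All⇒MeanAtMost []       = z≤n
All⇒MeanAtMost (h ∷ hs) = +-mono-≤ h (All⇒MeanAtMost hs)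

All⇒length*≤sum : ∀ {z xs} → All (z ≤_) xs → length xs * z ≤ sum xs
All⇒length*≤sum []       = z≤n
All⇒length*≤sum (h ∷ hs) = +-mono-≤ h (All⇒length*≤sum hs)

MeanAtMost-↭ : ∀ {a xs ys} → xs ↭ ys → MeanAtMost a xs → MeanAtMost a ys
MeanAtMost-↭ {a} p h = subst₂ (λ s n → s ≤ n * a) (sum-↭ p) (↭-length p) h

MeanAtMost-zipWith : ∀ {a b} xs ys → length xs ≡ length ys →
  MeanAtMost a xs → MeanAtMost b ys → MeanAtMost (a + b) (zipWith _+_ xs ys)
MeanAtMost-zipWith {a} {b} xs ys eq hx hy = begin
  sum (zipWith _+_ xs ys)           ≡⟨ sum-zipWith-+ xs ys eq ⟩
  sum xs + sum ys                   ≤⟨ +-mono-≤ hx hy ⟩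
  length xs * a + length ys * b     ≡⟨ cong (λ n → length xs * a + n * b) eq ⟨
  length xs * a + length xs * b     ≡⟨ *-distribˡ-+ (length xs) a b ⟨
  length xs * (a + b)               ≡⟨ cong (_* (a + b)) (length-zipWith-≡ _+_ xs ys eq) ⟨
  length (zipWith _+_ xs ys) * (a + b) ∎
  where open ≤-Reasoning

MeanAtMost-filter-above⁻ : ∀ {y c} xs → MeanAtMost (y + c) (filter (y <?_) xs) → MeanAtMost (y + c) xs
MeanAtMost-filter-above⁻ {y} {c} xs h = MeanAtMost-↭ (filter-++-reject-↭ (y <?_) xs)
  (MeanAtMost-++ (filter (y <?_) xs) (filter (∁? (y <?_)) xs) h
    (All⇒MeanAtMost (All.map y≮⇒≤y+c (all-filter (∁? (y <?_)) xs))))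
  where
  y≮⇒≤y+c : ∀ {z} → ¬ y < z → z ≤ y + c
  y≮⇒≤y+c y≮z = ≤-trans (≮⇒≥ y≮z) (m≤m+n y c)

MeanAtMost-++⁻ʳ : ∀ {a z} us vs → All (z ≤_) us → All (_≤ z) vs →
  MeanAtMost a (us ++ vs) → MeanAtMost a vs
MeanAtMost-++⁻ʳ us []         _   _   _ = z≤n
MeanAtMost-++⁻ʳ {a} {z} us vs@(_ ∷ _) us≥z vs≤z h = *-cancelˡ-≤ (n + m) (begin
  (n + m) * V           ≡⟨ *-distribʳ-+ V n m ⟩
  n * V + m * V         ≤⟨ +-monoʳ-≤ (n * V) (*-monoʳ-≤ m (All⇒MeanAtMost vs≤z)) ⟩
  n * V + m * (n * z)   ≡⟨ cong (λ s → n * V + s) (*-left-comm m n z) ⟩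
  n * V + n * (m * z)   ≤⟨ +-monoʳ-≤ (n * V) (*-monoʳ-≤ n (All⇒length*≤sum us≥z)) ⟩
  n * V + n * U         ≡⟨ *-distribˡ-+ n V U ⟨
  n * (V + U)           ≡⟨ cong (n *_) (trans (+-comm V U) (sym (sum-++ us vs))) ⟩
  n * sum (us ++ vs)    ≤⟨ *-monoʳ-≤ n h ⟩
  n * (length (us ++ vs) * a) ≡⟨ cong (λ l → n * (l * a)) (trans (length-++ us) (+-comm m n)) ⟩
  n * ((n + m) * a)     ≡⟨ *-left-comm n (n + m) a ⟩
  (n + m) * (n * a)     ∎)
  where
  open ≤-Reasoning
  m = length us
  n = length vs
  U = sum us
  V = sum vs

Balanced : ℕ → List ℕ → Set
Balanced c xs = ∀ x → Any (_≤ x) xs → MeanAtMost (x + c) (filter (x <?_) xs)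

Balanced-↭ : ∀ {c xs ys} → xs ↭ ys → Balanced c xs → Balanced c ys
Balanced-↭ xs↭ys bal x any =
  MeanAtMost-↭ (filter-↭ (x <?_) xs↭ys) (bal x (Any-resp-↭ (↭-sym xs↭ys) any))

Balanced-[] : ∀ {c} → Balanced c []
Balanced-[] x ()

Balanced-[_] : ∀ {c} y → Balanced c [ y ]
Balanced-[ y ] x (here y≤x) = subst (MeanAtMost _) (sym (filter-reject (x <?_) (≤⇒≯ y≤x))) z≤n

Balanced⇒MeanAtMost-above : ∀ {c} xs → Balanced c xs → MeanAtMost c xs →
  ∀ x → MeanAtMost (x + c) (filter (x <?_) xs)
Balanced⇒MeanAtMost-above {c} xs bal mean x with any? (_≤? x) xs
... | yes any = bal x any
... | no ¬any = subst (MeanAtMost (x + c)) (sym (filter-all (x <?_) (All.map ≰⇒> (¬Any⇒All¬ xs ¬any))))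
  (MeanAtMost-mono xs (m≤n+m c x) mean)

Balanced-++ : ∀ {c} xs ys → Balanced c xs → MeanAtMost c xs → Balanced c ys → MeanAtMost c ys →
  Balanced c (xs ++ ys)
Balanced-++ xs ys balx meanx baly meany x _ = subst (MeanAtMost _) (sym (filter-++ (x <?_) xs ys))
  (MeanAtMost-++ (filter (x <?_) xs) (filter (x <?_) ys)
    (Balanced⇒MeanAtMost-above xs balx meanx x) (Balanced⇒MeanAtMost-above ys baly meany x))

Balanced⇒MeanAtMost-before : ∀ {c y} us vs → Balanced c (us ++ y ∷ vs) → All (_≤ y) vs →
  MeanAtMost (y + c) us
Balanced⇒MeanAtMost-before {c} {y} us vs bal vs≤y = MeanAtMost-filter-above⁻ us
  (subst (MeanAtMost (y + c)) filter-us (bal y (++⁺ʳ us (here ≤-refl))))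
  where
  filter-us : filter (y <?_) (us ++ y ∷ vs) ≡ filter (y <?_) us
  filter-us = trans (filter-++ (y <?_) us (y ∷ vs))
    (trans (cong (filter (y <?_) us ++_) (filter-none (y <?_) (All.map ≤⇒≯ (≤-refl ∷ vs≤y))))
           (++-identityʳ _))

Balanced⇒MeanAtMost-tail : ∀ {c y} vs → Balanced c (y ∷ vs) → MeanAtMost (y + c) vs
Balanced⇒MeanAtMost-tail {c} {y} vs bal = MeanAtMost-filter-above⁻ vs
  (subst (MeanAtMost (y + c)) (filter-reject (y <?_) (n≮n y)) (bal y (here ≤-refl)))

ascending-Balanced-++⁻ʳ : ∀ {c} us vs → AllPairs _≤_ (us ++ vs) → Balanced c (us ++ vs) →
  Balanced c vs
ascending-Balanced-++⁻ʳ {c} us vs asc bal x any =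
  subst (MeanAtMost (x + c)) filter-eq (bal x (++⁺ʳ us any))
  where
  us≤x : All (_≤ x) us
  us≤x = All.map (λ u≤vs → let u≤v , v≤x = All.lookupAny u≤vs any in ≤-trans u≤v v≤x)
                 (proj₁ (AllPairs-++⁻ us asc))
  filter-eq : filter (x <?_) (us ++ vs) ≡ filter (x <?_) vs
  filter-eq = trans (filter-++ (x <?_) us vs)
    (cong (_++ filter (x <?_) vs) (filter-none (x <?_) (All.map ≤⇒≯ us≤x)))

descending-Balanced-++⁻ʳ : ∀ {c} us vs → AllPairs _≥_ (us ++ vs) → Balanced c (us ++ vs) →
  Balanced c vs
descending-Balanced-++⁻ʳ {c} us vs@(v ∷ vs′) desc bal x any =
  MeanAtMost-++⁻ʳ (filter (x <?_) us) (filter (x <?_) vs)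
    (filter⁺ (x <?_) us≥v) (filter⁺ (x <?_) vs≤v)
    (subst (MeanAtMost (x + c)) (filter-++ (x <?_) us vs) (bal x (++⁺ʳ us any)))
  where
  split = AllPairs-++⁻ us desc
  us≥v : All (v ≤_) us
  us≥v = All.map All.head (proj₁ split)
  vs≤v : All (_≤ v) vs
  vs≤v with proj₂ split
  ... | v≥vs′ ∷ _ = ≤-refl ∷ v≥vs′

record GreedyPair (c : ℕ) (ps qs : List ℕ) : Set where
  field
    descending : AllPairs _≥_ ps
    ascending  : AllPairs _≤_ qs
    balancedˡ  : Balanced c ps
    balancedʳ  : Balanced c qs

GreedyPair-++⁻ʳ : ∀ {c} us vs {ps qs} → GreedyPair c (us ++ ps) (vs ++ qs) → GreedyPair c ps qs
GreedyPair-++⁻ʳ us vs {ps} {qs} G = record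
  { descending = proj₂ (AllPairs-++⁻ us descending)
  ; ascending  = proj₂ (AllPairs-++⁻ vs ascending)
  ; balancedˡ  = descending-Balanced-++⁻ʳ us ps descending balancedˡ
  ; balancedʳ  = ascending-Balanced-++⁻ʳ vs qs ascending balancedʳ
  }
  where open GreedyPair G

-- The entries p + q ≤ x cut zipWith _+_ ps qs into blocks of entries above x; P₀ and Q₀
-- collect the current block. On a block followed by p + q the descending entries have mean at
-- most p + c and the ascending ones are at most q; after the last such p + q the descending
-- entries are at most p and the ascending ones have mean at most q + c. Either way the block
-- has mean at most x + c, and the remaining suffixes are again a greedy pair.
module _ (c x : ℕ) where

  zipWith-MeanAtMost-above : ∀ P₀ Q₀ ps qs → length P₀ ≡ length Q₀ → length ps ≡ length qs →
    GreedyPair c (P₀ ++ ps) (Q₀ ++ qs) → Any (_≤ x) (zipWith _+_ ps qs) →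
    MeanAtMost (x + c) (zipWith _+_ P₀ Q₀ ++ filter (x <?_) (zipWith _+_ ps qs))
  zipWith-MeanAtMost-above P₀ Q₀ (p ∷ ps) (q ∷ qs) eq₀ eq G any with x <? p + q
  ... | yes x<r = subst (MeanAtMost (x + c)) moved
        (zipWith-MeanAtMost-above (P₀ ∷ʳ p) (Q₀ ∷ʳ q) ps qs eq₀′ (suc-injective eq)
          (subst₂ (GreedyPair c) (sym (∷ʳ-++ P₀ p ps)) (sym (∷ʳ-++ Q₀ q qs)) G) (tail-any any))
    where
    eq₀′ : length (P₀ ∷ʳ p) ≡ length (Q₀ ∷ʳ q)
    eq₀′ = trans (length-++ P₀) (trans (cong (_+ 1) eq₀) (sym (length-++ Q₀)))
    tail-any : Any (_≤ x) (zipWith _+_ (p ∷ ps) (q ∷ qs)) → Any (_≤ x) (zipWith _+_ ps qs)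
    tail-any (here r≤x) = ⊥-elim (<⇒≱ x<r r≤x)
    tail-any (there a)  = a
    moved : zipWith _+_ (P₀ ∷ʳ p) (Q₀ ∷ʳ q) ++ filter (x <?_) (zipWith _+_ ps qs)
          ≡ zipWith _+_ P₀ Q₀ ++ filter (x <?_) (zipWith _+_ (p ∷ ps) (q ∷ qs))
    moved = trans (zipWith-∷ʳ-++ _+_ P₀ Q₀ eq₀)
                  (cong (zipWith _+_ P₀ Q₀ ++_) (sym (filter-accept (x <?_) x<r)))
  ... | no x≮r = subst (MeanAtMost (x + c)) (sym dropped)
        (MeanAtMost-++ (zipWith _+_ P₀ Q₀) (filter (x <?_) (zipWith _+_ ps qs)) block rest)
    where
    open GreedyPair G
    r≤x : p + q ≤ x
    r≤x = ≮⇒≥ x≮r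
    G′ : GreedyPair c (p ∷ ps) (q ∷ qs)
    G′ = GreedyPair-++⁻ʳ P₀ Q₀ G
    ps≤p : All (_≤ p) ps
    ps≤p with GreedyPair.descending G′
    ... | p≥ps ∷ _ = p≥ps
    Q₀≤q : All (_≤ q) Q₀
    Q₀≤q = All.map All.head (proj₁ (AllPairs-++⁻ Q₀ ascending))
    block : MeanAtMost (x + c) (zipWith _+_ P₀ Q₀)
    block = MeanAtMost-mono (zipWith _+_ P₀ Q₀)
      (≤-trans (≤-reflexive (+-right-comm p c q)) (+-monoˡ-≤ c r≤x))
      (MeanAtMost-zipWith P₀ Q₀ eq₀
        (Balanced⇒MeanAtMost-before P₀ ps balancedˡ ps≤p) (All⇒MeanAtMost Q₀≤q))
    rest : MeanAtMost (x + c) (filter (x <?_) (zipWith _+_ ps qs))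
    rest with any? (_≤? x) (zipWith _+_ ps qs)
    ... | yes a =
      zipWith-MeanAtMost-above [] [] ps qs refl (suc-injective eq) (GreedyPair-++⁻ʳ [ p ] [ q ] G′) a
    ... | no ¬a = subst (MeanAtMost (x + c)) (sym (filter-all (x <?_) (All.map ≰⇒> (¬Any⇒All¬ _ ¬a))))
          (MeanAtMost-mono (zipWith _+_ ps qs)
            (≤-trans (≤-reflexive (sym (+-assoc p q c))) (+-monoˡ-≤ c r≤x))
            (MeanAtMost-zipWith ps qs (suc-injective eq) (All⇒MeanAtMost ps≤p)
              (Balanced⇒MeanAtMost-tail qs (GreedyPair.balancedʳ G′))))
    dropped : zipWith _+_ P₀ Q₀ ++ filter (x <?_) (zipWith _+_ (p ∷ ps) (q ∷ qs))
            ≡ zipWith _+_ P₀ Q₀ ++ filter (x <?_) (zipWith _+_ ps qs)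
    dropped = cong (zipWith _+_ P₀ Q₀ ++_) (filter-reject (x <?_) x≮r)

Balanced-zipWith : ∀ {c ps qs} → length ps ≡ length qs → GreedyPair c ps qs →
  Balanced c (zipWith _+_ ps qs)
Balanced-zipWith {c} {ps} {qs} eq G x any = zipWith-MeanAtMost-above c x [] [] ps qs refl eq G any

-- m entries with sum s precede qs; this is the form in which scoreGo evaluates the score.
PrefixBound : ℕ → ℕ → ℕ → List ℕ → Set
PrefixBound c m s []       = ⊤
PrefixBound c m s (q ∷ qs) = s ≤ m * (q + c) × PrefixBound c (suc m) (s + q) qs

descending-Balanced⇒PrefixBound : ∀ {c} us ds → AllPairs _≥_ (us ++ ds) → Balanced c (us ++ ds) →
  PrefixBound c (length us) (sum us) ds
descending-Balanced⇒PrefixBound us []        _    _   = tt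
descending-Balanced⇒PrefixBound {c} us (q ∷ ds) desc bal =
  Balanced⇒MeanAtMost-before us ds bal q≥ds ,
  subst₂ (λ m s → PrefixBound c m s ds) length-us∷ʳq sum-us∷ʳq
    (descending-Balanced⇒PrefixBound (us ∷ʳ q) ds (subst (AllPairs _≥_) (sym (∷ʳ-++ us q ds)) desc)
                                                 (subst (Balanced c) (sym (∷ʳ-++ us q ds)) bal))
  where
  q≥ds : All (_≤ q) ds
  q≥ds with proj₂ (AllPairs-++⁻ us desc)
  ... | q≥ds ∷ _ = q≥ds
  length-us∷ʳq : length (us ∷ʳ q) ≡ suc (length us)
  length-us∷ʳq = trans (length-++ us) (+-comm (length us) 1)
  sum-us∷ʳq : sum (us ∷ʳ q) ≡ sum us + q
  sum-us∷ʳq = trans (sum-++ us [ q ]) (cong (λ t → sum us + t) (+-identityʳ q))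

PrefixBound⇒MeanAtMost-above : ∀ {c x} m s ds → AllPairs _≥_ ds → PrefixBound c m s ds →
  Any (_≤ x) ds →
  s + sum (filter (x <?_) ds) ≤ (m + length (filter (x <?_) ds)) * (x + c)
PrefixBound⇒MeanAtMost-above {c} {x} m s (q ∷ ds) (q≥ds ∷ desc) (s≤ , bound) any with x <? q
... | yes x<q = subst (λ F → s + sum F ≤ (m + length F) * (x + c)) (sym (filter-accept (x <?_) x<q)) (begin
  s + (q + sum F)             ≡⟨ +-assoc s q (sum F) ⟨
  (s + q) + sum F             ≤⟨ PrefixBound⇒MeanAtMost-above (suc m) (s + q) ds desc bound (tail-any any) ⟩
  (suc m + length F) * (x + c) ≡⟨ cong (_* (x + c)) (+-suc m (length F)) ⟨
  (m + suc (length F)) * (x + c) ∎)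
  where
  open ≤-Reasoning
  F = filter (x <?_) ds
  tail-any : Any (_≤ x) (q ∷ ds) → Any (_≤ x) ds
  tail-any (here q≤x) = ⊥-elim (<⇒≱ x<q q≤x)
  tail-any (there a)  = a
... | no x≮q = subst (λ F → s + sum F ≤ (m + length F) * (x + c)) (sym filter-empty) (begin
  s + 0             ≡⟨ +-identityʳ s ⟩
  s                 ≤⟨ s≤ ⟩
  m * (q + c)       ≤⟨ *-monoʳ-≤ m (+-monoˡ-≤ c (≮⇒≥ x≮q)) ⟩
  m * (x + c)       ≡⟨ cong (_* (x + c)) (+-identityʳ m) ⟨
  (m + 0) * (x + c) ∎)
  where
  open ≤-Reasoning
  filter-empty : filter (x <?_) (q ∷ ds) ≡ []
  filter-empty = trans (filter-reject (x <?_) x≮q)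
    (filter-none (x <?_) (All.map (λ z≤q → ≤⇒≯ (≤-trans z≤q (≮⇒≥ x≮q))) q≥ds))

descending-PrefixBound⇒Balanced : ∀ {c} ds → AllPairs _≥_ ds → PrefixBound c 0 0 ds → Balanced c ds
descending-PrefixBound⇒Balanced ds desc bound x = PrefixBound⇒MeanAtMost-above 0 0 ds desc bound

descending-Balanced⇔PrefixBound : ∀ {c ds} → AllPairs _≥_ ds → Balanced c ds ⇔ PrefixBound c 0 0 ds
descending-Balanced⇔PrefixBound {ds = ds} desc =
  mk⇔ (descending-Balanced⇒PrefixBound [] ds desc) (descending-PrefixBound⇒Balanced ds desc)

toℚᵘ-toℚ : ∀ n → Q.toℚᵘ (toℚ n) ≃ᵘ mkℚᵘ (+ n) 0
toℚᵘ-toℚ n = Q.toℚᵘ-fromℚᵘ (mkℚᵘ (+ n) 0)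

toℚ-+ : ∀ m n → toℚ (m + n) ≡ toℚ m Q.+ toℚ n
toℚ-+ m n = Q.toℚᵘ-injective (begin
  Q.toℚᵘ (toℚ (m + n))                 ≈⟨ toℚᵘ-toℚ (m + n) ⟩
  mkℚᵘ (+ (m + n)) 0                   ≈⟨ *≡* (cong (ℤ._* + 1) (sym numerator)) ⟩
  mkℚᵘ (+ m) 0 ℚᵘ.+ mkℚᵘ (+ n) 0       ≈⟨ ℚᵘ.+-cong (toℚᵘ-toℚ m) (toℚᵘ-toℚ n) ⟨
  Q.toℚᵘ (toℚ m) ℚᵘ.+ Q.toℚᵘ (toℚ n)   ≈⟨ Q.toℚᵘ-homo-+ (toℚ m) (toℚ n) ⟨
  Q.toℚᵘ (toℚ m Q.+ toℚ n)             ∎)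
  where
  open ℚᵘ.≃-Reasoning
  numerator : (+ m ℤ.* + 1) ℤ.+ (+ n ℤ.* + 1) ≡ + (m + n)
  numerator = trans (cong₂ ℤ._+_ (ℤ.*-identityʳ (+ m)) (ℤ.*-identityʳ (+ n))) (sym (ℤ.pos-+ m n))

toℚ-* : ∀ m n → toℚ (m * n) ≡ toℚ m Q.* toℚ n
toℚ-* m n = Q.toℚᵘ-injective (begin
  Q.toℚᵘ (toℚ (m * n))                 ≈⟨ toℚᵘ-toℚ (m * n) ⟩
  mkℚᵘ (+ (m * n)) 0                   ≈⟨ *≡* (cong (ℤ._* + 1) (ℤ.pos-* m n)) ⟩
  mkℚᵘ (+ m) 0 ℚᵘ.* mkℚᵘ (+ n) 0       ≈⟨ ℚᵘ.*-cong (toℚᵘ-toℚ m) (toℚᵘ-toℚ n) ⟨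
  Q.toℚᵘ (toℚ m) ℚᵘ.* Q.toℚᵘ (toℚ n)   ≈⟨ Q.toℚᵘ-homo-* (toℚ m) (toℚ n) ⟨
  Q.toℚᵘ (toℚ m Q.* toℚ n)             ∎)
  where open ℚᵘ.≃-Reasoning

toℚ-≤ : ∀ {m n} → m ≤ n ⇔ toℚ m Q.≤ toℚ n
toℚ-≤ {m} {n} = mk⇔
  (λ m≤n → Q.toℚᵘ-cancel-≤ (ℚᵘ.≤-respʳ-≃ (ℚᵘ.≃-sym (toℚᵘ-toℚ n)) (ℚᵘ.≤-respˡ-≃ (ℚᵘ.≃-sym (toℚᵘ-toℚ m))
     (*≤* (ℤ.*-monoʳ-≤-nonNeg (+ 1) (ℤ.+≤+ m≤n))))))
  (λ h → case ℚᵘ.≤-respʳ-≃ (toℚᵘ-toℚ n) (ℚᵘ.≤-respˡ-≃ (toℚᵘ-toℚ m) (Q.toℚᵘ-mono-≤ h)) of λ where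
     (*≤* le) → ℤ.drop‿+≤+ (subst₂ ℤ._≤_ (ℤ.*-identityʳ _) (ℤ.*-identityʳ _) le))

toℚ-positive : ∀ n → Q.Positive (toℚ (suc n))
toℚ-positive n = Q.normalize-pos (suc n) 1

toℚ-nonNegative : ∀ n → Q.NonNegative (toℚ n)
toℚ-nonNegative n = Q.normalize-nonNeg n 1

[1+n]*[s/[1+n]]≡s : ∀ n s → toℚ (suc n) Q.* ((+ s) / suc n) ≡ toℚ s
[1+n]*[s/[1+n]]≡s n s = Q.toℚᵘ-injective (begin
  Q.toℚᵘ (toℚ (suc n) Q.* ((+ s) / suc n))          ≈⟨ Q.toℚᵘ-homo-* (toℚ (suc n)) ((+ s) / suc n) ⟩
  Q.toℚᵘ (toℚ (suc n)) ℚᵘ.* Q.toℚᵘ ((+ s) / suc n) ≈⟨ ℚᵘ.*-cong (toℚᵘ-toℚ (suc n)) (Q.toℚᵘ-fromℚᵘ _) ⟩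
  mkℚᵘ (+ suc n) 0 ℚᵘ.* mkℚᵘ (+ s) n               ≈⟨ *≡* cross ⟩
  mkℚᵘ (+ s) 0                                      ≈⟨ toℚᵘ-toℚ s ⟨
  Q.toℚᵘ (toℚ s)                                    ∎)
  where
  open ℚᵘ.≃-Reasoning
  cross : (+ suc n ℤ.* + s) ℤ.* + 1 ≡ + s ℤ.* + (suc n + 0)
  cross = trans (ℤ.*-identityʳ _)
    (trans (ℤ.*-comm (+ suc n) (+ s)) (cong (λ d → + s ℤ.* + d) (sym (+-identityʳ (suc n)))))

s/[1+n]≤r⇔s≤[1+n]*r : ∀ n s r → (+ s) / suc n Q.≤ r ⇔ toℚ s Q.≤ toℚ (suc n) Q.* r
s/[1+n]≤r⇔s≤[1+n]*r n s r = mk⇔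
  (λ h → subst (Q._≤ toℚ (suc n) Q.* r) ([1+n]*[s/[1+n]]≡s n s)
                (Q.*-monoˡ-≤-nonNeg (toℚ (suc n)) {{toℚ-nonNegative (suc n)}} h))
  (λ h → Q.*-cancelˡ-≤-pos (toℚ (suc n)) {{toℚ-positive n}}
                (subst (Q._≤ toℚ (suc n) Q.* r) (sym ([1+n]*[s/[1+n]]≡s n s)) h))

p-q≤r⇔p≤q+r : ∀ p q r → p Q.- q Q.≤ r ⇔ p Q.≤ q Q.+ r
p-q≤r⇔p≤q+r p q r = mk⇔
  (λ h → Q.≤-trans (Q.≤-reflexive (q+[p-q] p q)) (Q.+-monoʳ-≤ q h))
  (λ h → Q.≤-trans (Q.+-monoˡ-≤ (Q.- q) h) (Q.≤-reflexive ([q+r]-q q r)))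
  where
  open +-*-Solver
  q+[p-q] : ∀ p q → p ≡ q Q.+ (p Q.- q)
  q+[p-q] = solve 2 (λ p q → p := q :+ (p :- q)) refl
  [q+r]-q : ∀ q r → (q Q.+ r) Q.- q ≡ r
  [q+r]-q = solve 2 (λ q r → (q :+ r) :- q := r) refl

score-term-≤⇔ : ∀ n s q c → (+ s) / suc n Q.- toℚ q Q.≤ toℚ c ⇔ s ≤ suc n * (q + c)
score-term-≤⇔ n s q c = begin
  (+ s) / suc n Q.- toℚ q Q.≤ toℚ c           ∼⟨ p-q≤r⇔p≤q+r _ _ _ ⟩
  (+ s) / suc n Q.≤ toℚ q Q.+ toℚ c           ≡⟨ cong ((+ s) / suc n Q.≤_) (toℚ-+ q c) ⟨
  (+ s) / suc n Q.≤ toℚ (q + c)               ∼⟨ s/[1+n]≤r⇔s≤[1+n]*r n s _ ⟩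
  toℚ s Q.≤ toℚ (suc n) Q.* toℚ (q + c)       ≡⟨ cong (toℚ s Q.≤_) (toℚ-* (suc n) (q + c)) ⟨
  toℚ s Q.≤ toℚ (suc n * (q + c))             ∼⟨ ⇔-sym toℚ-≤ ⟩
  s ≤ suc n * (q + c)                         ∎
  where open EquationalReasoning

maxQ-≤⇔ : ∀ xs y → maxQ xs ≤S just y ⇔ All (Q._≤ y) xs
maxQ-≤⇔ xs y = mk⇔ (to xs) (from xs)
  where
  to : ∀ xs → maxQ xs ≤S just y → All (Q._≤ y) xs
  to []       _ = []
  to (x ∷ xs) h with maxQ xs | to xs
  ... | nothing | ih = h ∷ ih tt
  ... | just z  | ih = Q.p⊔q≤r⇒p≤r x z h ∷ ih (Q.p⊔q≤r⇒q≤r x z h)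
  from : ∀ xs → All (Q._≤ y) xs → maxQ xs ≤S just y
  from []       []       = tt
  from (x ∷ xs) (h ∷ hs) with maxQ xs | from xs hs
  ... | nothing | _  = h
  ... | just z  | ih = Q.⊔-lub h ih

scoreGo-≤⇔ : ∀ c n s qs → All (Q._≤ toℚ c) (scoreGo n s qs) ⇔ PrefixBound c (suc n) s qs
scoreGo-≤⇔ c n s qs = mk⇔ (to n s qs) (from n s qs)
  where
  to : ∀ n s qs → All (Q._≤ toℚ c) (scoreGo n s qs) → PrefixBound c (suc n) s qs
  to n s []       []       = tt
  to n s (q ∷ qs) (h ∷ hs) = Equivalence.to (score-term-≤⇔ n s q c) h , to (suc n) (s + q) qs hs
  from : ∀ n s qs → PrefixBound c (suc n) s qs → All (Q._≤ toℚ c) (scoreGo n s qs)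
  from n s []       tt       = []
  from n s (q ∷ qs) (h , hs) = Equivalence.from (score-term-≤⇔ n s q c) h ∷ from (suc n) (s + q) qs hs

scoreTerms-≤⇔ : ∀ c ds → maxQ (scoreTerms ds) ≤S just (toℚ c) ⇔ PrefixBound c 0 0 ds
scoreTerms-≤⇔ c []       = mk⇔ (λ _ → tt) (λ _ → tt)
scoreTerms-≤⇔ c (p ∷ ps) = mk⇔
  (λ h → z≤n , Equivalence.to (scoreGo-≤⇔ c 0 p ps) (Equivalence.to (maxQ-≤⇔ _ _) h))
  (λ (_ , h) → Equivalence.from (maxQ-≤⇔ _ _) (Equivalence.from (scoreGo-≤⇔ c 0 p ps) h))

sortDesc-↭ : ∀ xs → sortDesc xs ↭ xs
sortDesc-↭ xs = ↭-trans (↭-reverse (sort xs)) (sort-↭ xs)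

sortDesc-descending : ∀ xs → AllPairs _≥_ (sortDesc xs)
sortDesc-descending xs = AllPairs-reverse (Linked⇒AllPairs ≤-trans (sort-↗ xs))

score-≤⇔Balanced : ∀ {T} c (R : Profile T) → score R ≤S just (toℚ c) ⇔ Balanced c (map len R)
score-≤⇔Balanced c R = begin
  score R ≤S just (toℚ c)   ∼⟨ scoreTerms-≤⇔ c ds ⟩
  PrefixBound c 0 0 ds      ∼⟨ ⇔-sym (descending-Balanced⇔PrefixBound (sortDesc-descending _)) ⟩
  Balanced c ds             ∼⟨ mk⇔ (Balanced-↭ ds↭R) (Balanced-↭ (↭-sym ds↭R)) ⟩
  Balanced c (map len R)    ∎
  where
  open EquationalReasoning
  ds = sortDesc (map len R)
  ds↭R = sortDesc-↭ (map len R)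

prefix-step : ∀ m S q M → S ≤ m * (q + M) → suc m * S ≤ m * (S + q) + m * M
prefix-step m S q M S≤ = begin
  S + m * S               ≤⟨ +-monoˡ-≤ (m * S) S≤ ⟩
  m * (q + M) + m * S     ≡⟨ regroup m S q M ⟩
  m * (S + q) + m * M     ∎
  where
  open ≤-Reasoning
  regroup : ∀ m S q M → m * (q + M) + m * S ≡ m * (S + q) + m * M
  regroup = solve-∀

-- S is the sum of the first m entries. By prefix-step, S / m ≤ S′ / (m + 1) + M / (m + 1) for
-- the next sum S′; telescoping down to the mean bound M gives the claim, multiplied by m.
harmonic-bound : ∀ M m S rest → PrefixBound M m S rest → S + sum rest ≤ (m + length rest) * M →
  toℚ S Q.≤ toℚ m Q.* toℚ M Q.* (1ℚ Q.+ H (m + length rest) Q.- H m)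
harmonic-bound M m S [] _ total = begin
  toℚ S                                     ≤⟨ Equivalence.to toℚ-≤ S≤m*M ⟩
  toℚ (m * M)                               ≡⟨ toℚ-* m M ⟩
  toℚ m Q.* toℚ M                           ≡⟨ a≡a*[1+h-h] (toℚ m Q.* toℚ M) (H m) ⟩
  toℚ m Q.* toℚ M Q.* (1ℚ Q.+ H m Q.- H m)  ≡⟨ cong (λ k → toℚ m Q.* toℚ M Q.* (1ℚ Q.+ H k Q.- H m)) (+-identityʳ m) ⟨
  toℚ m Q.* toℚ M Q.* (1ℚ Q.+ H (m + 0) Q.- H m) ∎
  where
  open Q.≤-Reasoning
  open +-*-Solver
  S≤m*M : S ≤ m * M
  S≤m*M = subst₂ (λ s k → s ≤ k * M) (+-identityʳ S) (+-identityʳ m) total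
  a≡a*[1+h-h] : ∀ a h → a ≡ a Q.* (1ℚ Q.+ h Q.- h)
  a≡a*[1+h-h] = solve 2 (λ a h → a := a :* (con 1ℚ :+ h :- h)) refl
harmonic-bound M m S (q ∷ rest) (S≤ , bound) total = Q.*-cancelˡ-≤-pos D {{toℚ-positive m}} (begin
  D Q.* toℚ S                                ≡⟨ toℚ-* (suc m) S ⟨
  toℚ (suc m * S)                            ≤⟨ Equivalence.to toℚ-≤ (prefix-step m S q M S≤) ⟩
  toℚ (m * (S + q) + m * M)                  ≡⟨ toℚ-+ (m * (S + q)) (m * M) ⟩
  toℚ (m * (S + q)) Q.+ toℚ (m * M)          ≡⟨ cong₂ Q._+_ (toℚ-* m (S + q)) (toℚ-* m M) ⟩
  m′ Q.* toℚ (S + q) Q.+ m′ Q.* M′           ≤⟨ Q.+-monoˡ-≤ (m′ Q.* M′) (Q.*-monoˡ-≤-nonNeg m′ {{m′≥0}} ih) ⟩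
  m′ Q.* (D Q.* M′ Q.* X) Q.+ m′ Q.* M′      ≡⟨ factor-D m′ M′ X ⟩
  D Q.* (m′ Q.* M′ Q.* (X Q.+ u))            ≡⟨ cong (λ y → D Q.* (m′ Q.* M′ Q.* y)) (telescope (H K) (H m) u) ⟩
  D Q.* (m′ Q.* M′ Q.* (1ℚ Q.+ H K Q.- H m)) ∎)
  where
  open Q.≤-Reasoning
  open +-*-Solver
  m′ = toℚ m
  M′ = toℚ M
  m′≥0 = toℚ-nonNegative m
  D = toℚ (suc m)
  u = (+ 1) / suc m
  K = m + suc (length rest)
  X = 1ℚ Q.+ H K Q.- H (suc m)
  ih : toℚ (S + q) Q.≤ D Q.* M′ Q.* X
  ih = subst (λ k → toℚ (S + q) Q.≤ D Q.* M′ Q.* (1ℚ Q.+ H k Q.- H (suc m))) (sym (+-suc m (length rest)))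
         (harmonic-bound M (suc m) (S + q) rest bound
           (subst₂ (λ s k → s ≤ k * M) (sym (+-assoc S q (sum rest))) (+-suc m (length rest)) total))
  factor-D : ∀ a b x → a Q.* (D Q.* b Q.* x) Q.+ a Q.* b ≡ D Q.* (a Q.* b Q.* (x Q.+ u))
  factor-D a b x = begin-equality
    a Q.* (D Q.* b Q.* x) Q.+ a Q.* b               ≡⟨ cong (y Q.+_) (Q.*-identityʳ (a Q.* b)) ⟨
    a Q.* (D Q.* b Q.* x) Q.+ a Q.* b Q.* 1ℚ        ≡⟨ cong (λ one → y Q.+ a Q.* b Q.* one) D*u≡1 ⟨
    a Q.* (D Q.* b Q.* x) Q.+ a Q.* b Q.* (D Q.* u) ≡⟨ regroup a D b x u ⟩
    D Q.* (a Q.* b Q.* (x Q.+ u))                   ∎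
    where
    y = a Q.* (D Q.* b Q.* x)
    D*u≡1 : D Q.* u ≡ 1ℚ
    D*u≡1 = [1+n]*[s/[1+n]]≡s m 1
    regroup : ∀ a d b x u →
      a Q.* (d Q.* b Q.* x) Q.+ a Q.* b Q.* (d Q.* u) ≡ d Q.* (a Q.* b Q.* (x Q.+ u))
    regroup = solve 5 (λ a d b x u →
      a :* (d :* b :* x) :+ a :* b :* (d :* u) := d :* (a :* b :* (x :+ u))) refl
  telescope : ∀ k h u → (1ℚ Q.+ k Q.- (h Q.+ u)) Q.+ u ≡ 1ℚ Q.+ k Q.- h
  telescope = solve 3 (λ k h u → (con 1ℚ :+ k :- (h :+ u)) :+ u := con 1ℚ :+ k :- h) refl

Balanced⇒max≤H*M : ∀ M xs → Balanced M xs → MeanAtMost M xs →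
  toℚ (foldr ℕ._⊔_ 0 xs) Q.≤ H (length xs) Q.* toℚ M
Balanced⇒max≤H*M M xs bal mean with sortDesc xs | sortDesc-↭ xs | sortDesc-descending xs
... | [] | ds↭xs | _ rewrite ↭-empty-inv (↭-sym ds↭xs) = Q.≤-reflexive (sym (Q.*-zeroˡ (toℚ M)))
... | p ∷ ps | ds↭xs | desc = begin
  toℚ (foldr ℕ._⊔_ 0 xs)           ≤⟨ Equivalence.to toℚ-≤ max≤p ⟩
  toℚ p                            ≤⟨ harmonic-bound M 1 p ps (proj₂ prefix) total ⟩
  1ℚ Q.* toℚ M Q.* (1ℚ Q.+ H (1 + length ps) Q.- H 1) ≡⟨ simplify (toℚ M) (H (1 + length ps)) ⟩
  H (length (p ∷ ps)) Q.* toℚ M    ≡⟨ cong (λ n → H n Q.* toℚ M) (↭-length ds↭xs) ⟩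
  H (length xs) Q.* toℚ M          ∎
  where
  open Q.≤-Reasoning
  open +-*-Solver
  max≤p : foldr ℕ._⊔_ 0 xs ≤ p
  max≤p = ⊔-lub-foldr (All-resp-↭ ds↭xs (≤-refl ∷ AllPairs.head desc))
  prefix : PrefixBound M 0 0 (p ∷ ps)
  prefix = Equivalence.to (descending-Balanced⇔PrefixBound desc) (Balanced-↭ (↭-sym ds↭xs) bal)
  total : p + sum ps ≤ (1 + length ps) * M
  total = MeanAtMost-↭ (↭-sym ds↭xs) mean
  simplify : ∀ a k → 1ℚ Q.* a Q.* (1ℚ Q.+ k Q.- (0ℚ Q.+ 1ℚ)) ≡ k Q.* a
  simplify = solve 2 (λ a k → con 1ℚ :* a :* (con 1ℚ :+ k :- (con 0ℚ :+ con 1ℚ)) := k :* a) refl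

longest : SP → ℕ
longest (arc τ)   = τ
longest (ser A B) = longest A + longest B
longest (par A B) = longest A ⊔ longest B

len≤longest : ∀ {T} (p : Path T) → len p ≤ longest T
len≤longest {arc τ}   edge      = ≤-refl
len≤longest           (seq p q) = +-mono-≤ (len≤longest p) (len≤longest q)
len≤longest {par A B} (inl p)   = ≤-trans (len≤longest p) (m≤m⊔n (longest A) (longest B))
len≤longest {par A B} (inr q)   = ≤-trans (len≤longest q) (m≤n⊔m (longest A) (longest B))

totLen≤length*longest : ∀ {T} (P : Profile T) → totLen P ≤ length P * longest T
totLen≤length*longest []      = z≤n
totLen≤length*longest (p ∷ P) = +-mono-≤ (len≤longest p) (totLen≤length*longest P)

Bounded : ∀ {T} → ℕ → Profile T → Set
Bounded c Q = All (λ r → len r ≤ c) Q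

maxLen-bounded : ∀ {T} (Q : Profile T) → Bounded (maxLen Q) Q
maxLen-bounded Q = All-map⁻ (≤-foldr-⊔ (map len Q))

totLen-↭ : ∀ {T} {P P′ : Profile T} → P ↭ P′ → totLen P ≡ totLen P′
totLen-↭ P↭P′ = sum-↭ (↭-map⁺ len P↭P′)

map-len-zipWith-seq : ∀ {A B} (P : Profile A) (Q : Profile B) →
  map len (zipWith seq P Q) ≡ zipWith _+_ (map len P) (map len Q)
map-len-zipWith-seq P Q = trans (map-zipWith seq len P Q) (sym (zipWith-map _+_ len len P Q))

map-len-greedyPar : ∀ {A B} (P : Profile A) (Q : Profile B) →
  map len (greedyPar P Q) ≡ map len P ++ map len Q
map-len-greedyPar P Q =
  trans (map-++ len (map inl P) (map inr Q)) (cong₂ _++_ (sym (map-∘ P)) (sym (map-∘ Q)))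

totLen-zipWith-seq : ∀ {A B} (P : Profile A) (Q : Profile B) → length P ≡ length Q →
  totLen (zipWith seq P Q) ≡ totLen P + totLen Q
totLen-zipWith-seq P Q eq = trans (cong sum (map-len-zipWith-seq P Q))
  (sum-zipWith-+ (map len P) (map len Q) (trans (length-map len P) (trans eq (sym (length-map len Q)))))

length-greedyPar : ∀ {A B} (P : Profile A) (Q : Profile B) → length (greedyPar P Q) ≡ length P + length Q
length-greedyPar P Q = trans (length-++ (map inl P)) (cong₂ _+_ (length-map inl P) (length-map inr Q))

totLen-greedyPar : ∀ {A B} (P : Profile A) (Q : Profile B) → totLen (greedyPar P Q) ≡ totLen P + totLen Q
totLen-greedyPar P Q = trans (cong sum (map-len-greedyPar P Q)) (sum-++ (map len P) (map len Q))

firstPart : ∀ {A B} → Path (ser A B) → Path A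
firstPart (seq p _) = p

secondPart : ∀ {A B} → Path (ser A B) → Path B
secondPart (seq _ q) = q

module _ {A B : SP} where

  len-firstPart≤ : (r : Path (ser A B)) → len (firstPart r) ≤ len r
  len-firstPart≤ (seq p q) = m≤m+n (len p) (len q)

  len-secondPart≤ : (r : Path (ser A B)) → len (secondPart r) ≤ len r
  len-secondPart≤ (seq p q) = m≤n+m (len q) (len p)

  Disj-firstPart : (r r′ : Path (ser A B)) → Disj r r′ → Disj (firstPart r) (firstPart r′)
  Disj-firstPart (seq _ _) (seq _ _) (d , _) = d

  Disj-secondPart : (r r′ : Path (ser A B)) → Disj r r′ → Disj (secondPart r) (secondPart r′)
  Disj-secondPart (seq _ _) (seq _ _) (_ , d) = d

  Disjoint-firstParts : {Q : Profile (ser A B)} → AllPairs Disj Q → AllPairs Disj (map firstPart Q)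
  Disjoint-firstParts disj = AllPairs-map⁺ (AllPairs.map (λ {r} {r′} → Disj-firstPart r r′) disj)

  Disjoint-secondParts : {Q : Profile (ser A B)} → AllPairs Disj Q → AllPairs Disj (map secondPart Q)
  Disjoint-secondParts disj = AllPairs-map⁺ (AllPairs.map (λ {r} {r′} → Disj-secondPart r r′) disj)

  Bounded-firstParts : ∀ {c} {Q : Profile (ser A B)} → Bounded c Q → Bounded c (map firstPart Q)
  Bounded-firstParts bounded = All-map⁺ (All.map (λ {r} → ≤-trans (len-firstPart≤ r)) bounded)

  Bounded-secondParts : ∀ {c} {Q : Profile (ser A B)} → Bounded c Q → Bounded c (map secondPart Q)
  Bounded-secondParts bounded = All-map⁺ (All.map (λ {r} → ≤-trans (len-secondPart≤ r)) bounded)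

  totLen-parts : (Q : Profile (ser A B)) → totLen (map firstPart Q) + totLen (map secondPart Q) ≡ totLen Q
  totLen-parts []            = refl
  totLen-parts (seq p q ∷ Q) =
    trans (interchange (len p) _ (len q) _) (cong (λ s → len p + len q + s) (totLen-parts Q))

lefts : ∀ {A B} → Profile (par A B) → Profile A
lefts []          = []
lefts (inl p ∷ Q) = p ∷ lefts Q
lefts (inr _ ∷ Q) = lefts Q

rights : ∀ {A B} → Profile (par A B) → Profile B
rights []          = []
rights (inl _ ∷ Q) = rights Q
rights (inr q ∷ Q) = q ∷ rights Q

module _ {A B : SP} where

  length-lefts-rights : (Q : Profile (par A B)) → length (lefts Q) + length (rights Q) ≡ length Q
  length-lefts-rights []          = refl
  length-lefts-rights (inl _ ∷ Q) = cong suc (length-lefts-rights Q)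
  length-lefts-rights (inr _ ∷ Q) = trans (+-suc (length (lefts Q)) _) (cong suc (length-lefts-rights Q))

  totLen-lefts-rights : (Q : Profile (par A B)) → totLen (lefts Q) + totLen (rights Q) ≡ totLen Q
  totLen-lefts-rights []          = refl
  totLen-lefts-rights (inl p ∷ Q) =
    trans (+-assoc (len p) _ _) (cong (λ s → len p + s) (totLen-lefts-rights Q))
  totLen-lefts-rights (inr q ∷ Q) =
    trans (x∙yz≈y∙xz (totLen (lefts Q)) (len q) _) (cong (λ s → len q + s) (totLen-lefts-rights Q))

  All-lefts : ∀ {P : Path (par A B) → Set} {Q} → All P Q → All (λ p → P (inl p)) (lefts Q)
  All-lefts {Q = []}        []       = []
  All-lefts {Q = inl _ ∷ _} (h ∷ hs) = h ∷ All-lefts hs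
  All-lefts {Q = inr _ ∷ _} (_ ∷ hs) = All-lefts hs

  All-rights : ∀ {P : Path (par A B) → Set} {Q} → All P Q → All (λ q → P (inr q)) (rights Q)
  All-rights {Q = []}        []       = []
  All-rights {Q = inl _ ∷ _} (_ ∷ hs) = All-rights hs
  All-rights {Q = inr _ ∷ _} (h ∷ hs) = h ∷ All-rights hs

  AllPairs-lefts : ∀ {R : Path (par A B) → Path (par A B) → Set} {Q} → AllPairs R Q →
    AllPairs (λ p p′ → R (inl p) (inl p′)) (lefts Q)
  AllPairs-lefts {Q = []}        []       = []
  AllPairs-lefts {Q = inl _ ∷ _} (h ∷ hs) = All-lefts h ∷ AllPairs-lefts hs
  AllPairs-lefts {Q = inr _ ∷ _} (_ ∷ hs) = AllPairs-lefts hs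

  AllPairs-rights : ∀ {R : Path (par A B) → Path (par A B) → Set} {Q} → AllPairs R Q →
    AllPairs (λ q q′ → R (inr q) (inr q′)) (rights Q)
  AllPairs-rights {Q = []}        []       = []
  AllPairs-rights {Q = inl _ ∷ _} (_ ∷ hs) = AllPairs-rights hs
  AllPairs-rights {Q = inr _ ∷ _} (h ∷ hs) = All-rights h ∷ AllPairs-rights hs

module SortAsc (T : SP) = Sort (On.decTotalOrder ≤-decTotalOrder (len {T}))
module SortDesc (T : SP) = Sort (Flip.decTotalOrder (On.decTotalOrder ≤-decTotalOrder (len {T})))

greedySer : ∀ {A B} → Profile A → Profile B → Profile (ser A B)
greedySer {A} {B} P Q = zipWith seq (SortDesc.sort A P) (SortAsc.sort B Q)

module _ {A B} {P : Profile A} {Q : Profile B} (same : length P ≡ length Q) where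

  private
    P↓ = SortDesc.sort A P
    Q↑ = SortAsc.sort B Q
    same↕ : length P↓ ≡ length Q↑
    same↕ = trans (↭-length (SortDesc.sort-↭ A P)) (trans same (sym (↭-length (SortAsc.sort-↭ B Q))))

  greedySer-GreedySer : GreedySer P Q (greedySer P Q)
  greedySer-GreedySer = P↓ , Q↑ , SortDesc.sort-↭ A P , SortAsc.sort-↭ B Q , same↕ ,
    Linked-map⁺ (SortDesc.sort-↗ A P) , Linked-map⁺ (SortAsc.sort-↗ B Q) , refl

  greedySer-Balanced : ∀ {c} → Balanced c (map len P) → Balanced c (map len Q) →
    Balanced c (map len (greedySer P Q))
  greedySer-Balanced {c} balP balQ = subst (Balanced c) (sym (map-len-zipWith-seq P↓ Q↑))
    (Balanced-zipWith (trans (length-map len P↓) (trans same↕ (sym (length-map len Q↑)))) (record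
      { descending = Linked⇒AllPairs (λ x≥y y≥z → ≤-trans y≥z x≥y) (Linked-map⁺ (SortDesc.sort-↗ A P))
      ; ascending  = Linked⇒AllPairs ≤-trans (Linked-map⁺ (SortAsc.sort-↗ B Q))
      ; balancedˡ  = Balanced-↭ (↭-map⁺ len (↭-sym (SortDesc.sort-↭ A P))) balP
      ; balancedʳ  = Balanced-↭ (↭-map⁺ len (↭-sym (SortAsc.sort-↭ B Q))) balQ
      }))

stored-shape : ∀ {T t} → Run T t → ∀ {k θ R} → t k θ ≡ just R → length R ≡ k × totLen R ≡ θ
stored-shape (leaf τ) {0} {0} refl = refl , refl
stored-shape (leaf τ) {1} {θ} eq with θ ℕ.≟ τ
stored-shape (leaf τ) {1} {θ} refl | yes refl = refl , +-identityʳ θ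
stored-shape (leaf τ) {1} {θ} ()   | no _
stored-shape (runSer t r₁ r₂ sel) {k} {θ} eq with proj₁ (proj₂ (sel k θ) _ eq)
... | θ₁ , θ₂ , P , Q , refl , e₁ , e₂ , P′ , Q′ , P′↭P , Q′↭Q , same , _ , _ , refl
  with stored-shape r₁ e₁ | stored-shape r₂ e₂
... | lenP , totP | _ , totQ =
  trans (length-zipWith-≡ seq P′ Q′ same) (trans (↭-length P′↭P) lenP) ,
  trans (totLen-zipWith-seq P′ Q′ same)
        (cong₂ _+_ (trans (totLen-↭ P′↭P) totP) (trans (totLen-↭ Q′↭Q) totQ))
stored-shape (runPar t r₁ r₂ sel) {k} {θ} eq with proj₁ (proj₂ (sel k θ) _ eq)
... | k₁ , k₂ , θ₁ , θ₂ , P , Q , refl , refl , e₁ , e₂ , refl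
  with stored-shape r₁ e₁ | stored-shape r₂ e₂
... | lenP , totP | lenQ , totQ =
  trans (length-greedyPar P Q) (cong₂ _+_ lenP lenQ) , trans (totLen-greedyPar P Q) (cong₂ _+_ totP totQ)

≤S-trans : ∀ a b {y} → a ≤S b → b ≤S just y → a ≤S just y
≤S-trans nothing  _        _   _   = tt
≤S-trans (just x) (just z) x≤z z≤y = Q.≤-trans x≤z z≤y

selected-Balanced : ∀ {T} {Cand : ℕ → ℕ → Profile T → Set} {t : Table T} → Selects Cand t →
  ∀ {k θ c} R → Cand k θ R → Balanced c (map len R) →
  Σ (Profile T) λ R₀ → t k θ ≡ just R₀ × Balanced c (map len R₀)
selected-Balanced {t = t} sel {k} {θ} {c} R cand bal with t k θ in eq
... | nothing = ⊥-elim (proj₁ (sel k θ) eq R cand)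
... | just R₀ = R₀ , refl , Equivalence.to (score-≤⇔Balanced c R₀)
  (≤S-trans (score R₀) (score R) (proj₂ (proj₂ (sel k θ) R₀ eq) R cand)
            (Equivalence.from (score-≤⇔Balanced c R) bal))

stored-MeanAtMost : ∀ {T t c} → Run T t → (Q : Profile T) → Bounded c Q →
  ∀ {R} → t (length Q) (totLen Q) ≡ just R → MeanAtMost c (map len R)
stored-MeanAtMost {c = c} run Q bounded {R} e with stored-shape run e
... | lenR , totR = begin
  totLen R                 ≡⟨ totR ⟩
  totLen Q                 ≤⟨ All⇒MeanAtMost (All-map⁺ bounded) ⟩
  length (map len Q) * c   ≡⟨ cong (_* c) (trans (length-map len Q) (sym (trans (length-map len R) lenR))) ⟩
  length (map len R) * c   ∎
  where open ≤-Reasoning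

cell-Balanced : ∀ {T t c} → Run T t → (Q : Profile T) → AllPairs Disj Q → Bounded c Q →
  Σ (Profile T) λ R → t (length Q) (totLen Q) ≡ just R × Balanced c (map len R)
cell-Balanced {c = c} (leaf τ) []          _ _ = [] , refl , Balanced-[] {c}
cell-Balanced         (leaf τ) (edge ∷ []) _ _ with τ + 0 ℕ.≟ τ
... | yes _ = edge ∷ [] , refl , Balanced-[ τ ]
... | no τ+0≢τ = ⊥-elim (τ+0≢τ (+-identityʳ τ))
cell-Balanced (leaf τ) (edge ∷ edge ∷ _) ((() ∷ _) ∷ _) _
cell-Balanced {c = c} (runSer {t₁ = t₁} {t₂ = t₂} t r₁ r₂ sel) Q disj bounded
  with cell-Balanced r₁ (map firstPart Q) (Disjoint-firstParts disj) (Bounded-firstParts bounded)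
     | cell-Balanced r₂ (map secondPart Q) (Disjoint-secondParts disj) (Bounded-secondParts bounded)
... | P₁ , e₁ , bal₁ | P₂ , e₂ , bal₂ =
  selected-Balanced sel (greedySer P₁ P₂) cand (greedySer-Balanced same bal₁ bal₂)
  where
  e₁′ : t₁ (length Q) (totLen (map firstPart Q)) ≡ just P₁
  e₁′ = subst (λ n → t₁ n (totLen (map firstPart Q)) ≡ just P₁) (length-map firstPart Q) e₁
  e₂′ : t₂ (length Q) (totLen (map secondPart Q)) ≡ just P₂
  e₂′ = subst (λ n → t₂ n (totLen (map secondPart Q)) ≡ just P₂) (length-map secondPart Q) e₂
  same : length P₁ ≡ length P₂
  same = trans (proj₁ (stored-shape r₁ e₁′)) (sym (proj₁ (stored-shape r₂ e₂′)))
  cand : CandSer t₁ t₂ (length Q) (totLen Q) (greedySer P₁ P₂)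
  cand = _ , _ , P₁ , P₂ , totLen-parts Q , e₁′ , e₂′ , greedySer-GreedySer same
cell-Balanced {c = c} (runPar {t₁ = t₁} {t₂ = t₂} t r₁ r₂ sel) Q disj bounded
  with cell-Balanced r₁ (lefts Q) (AllPairs-lefts disj) (All-lefts bounded)
     | cell-Balanced r₂ (rights Q) (AllPairs-rights disj) (All-rights bounded)
... | P₁ , e₁ , bal₁ | P₂ , e₂ , bal₂ =
  selected-Balanced sel (greedyPar P₁ P₂) cand
    (subst (Balanced c) (sym (map-len-greedyPar P₁ P₂))
      (Balanced-++ (map len P₁) (map len P₂)
        bal₁ (stored-MeanAtMost r₁ (lefts Q) (All-lefts bounded) e₁)
        bal₂ (stored-MeanAtMost r₂ (rights Q) (All-rights bounded) e₂)))
  where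
  cand : CandPar t₁ t₂ (length Q) (totLen Q) (greedyPar P₁ P₂)
  cand = _ , _ , _ , _ , P₁ , P₂ , length-lefts-rights Q , totLen-lefts-rights Q , e₁ , e₂ , refl

module _ {T : SP} (t : Table T) (k : ℕ) where

  best-cell : ∀ N {θ₀ P₀} → t k θ₀ ≡ just P₀ → θ₀ ≤ N →
    Σ ℕ λ θ → Σ (Profile T) λ P → t k θ ≡ just P ×
      (∀ θ′ P′ → θ′ ≤ N → t k θ′ ≡ just P′ → maxLen P ≤ maxLen P′)
  best-cell N {θ₀} {P₀} e₀ θ₀≤N = θ* , P* , e* , minimal
    where
    -- Empty cells cost more than the cell θ₀, so the cheapest cell is not empty.
    cost : ℕ → ℕ
    cost θ = maybe maxLen (suc (maxLen P₀)) (t k θ)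
    θ* = argmin cost θ₀ (upTo (suc N))
    cost-cell : ∀ {θ P} → t k θ ≡ just P → cost θ ≡ maxLen P
    cost-cell e = cong (maybe maxLen (suc (maxLen P₀))) e
    nonempty : ∀ θ → cost θ ≤ maxLen P₀ → Σ (Profile T) λ P → t k θ ≡ just P × cost θ ≡ maxLen P
    nonempty θ h with t k θ
    ... | just P  = P , refl , refl
    ... | nothing = ⊥-elim (1+n≰n h)
    found = nonempty θ* (subst (cost θ* ≤_) (cost-cell e₀) (f[argmin]≤f[⊤] {f = cost} θ₀ (upTo (suc N))))
    P* = proj₁ found
    e* = proj₁ (proj₂ found)
    minimal : ∀ θ′ P′ → θ′ ≤ N → t k θ′ ≡ just P′ → maxLen P* ≤ maxLen P′
    minimal θ′ P′ θ′≤N e′ = subst₂ _≤_ (proj₂ (proj₂ found)) (cost-cell e′)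
      (All.lookup (f[argmin]≤f[xs] {f = cost} θ₀ (upTo (suc N))) (∈-upTo⁺ (s≤s θ′≤N)))

stored-θ≤ : ∀ {T t} → Run T t → ∀ {k θ R} → t k θ ≡ just R → θ ≤ k * longest T
stored-θ≤ run {R = R} e with stored-shape run e
... | refl , refl = totLen≤length*longest R

stored-max≤H*M : ∀ {T t c} → Run T t → (Q : Profile T) → Bounded c Q →
  ∀ {R} → t (length Q) (totLen Q) ≡ just R → Balanced c (map len R) →
  toℚ (maxLen R) Q.≤ H (length Q) Q.* toℚ c
stored-max≤H*M {c = c} run Q bounded {R} stored balanced =
  subst (λ n → toℚ (maxLen R) Q.≤ H n Q.* toℚ c) length-R
    (Balanced⇒max≤H*M c (map len R) balanced (stored-MeanAtMost run Q bounded stored))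
  where
  length-R : length (map len R) ≡ length Q
  length-R = trans (length-map len R) (proj₁ (stored-shape run stored))

optimal-cell : ∀ {T t k θ₀ P₀} → Run T t → t k θ₀ ≡ just P₀ →
  Σ ℕ λ θ → Σ (Profile T) λ P → t k θ ≡ just P ×
    (∀ θ′ P′ → t k θ′ ≡ just P′ → maxLen P ≤ maxLen P′)
optimal-cell {T} {t} {k} run e₀ =
  let θ , P , e , best = best-cell t k (k * longest T) e₀ (stored-θ≤ run e₀)
  in  θ , P , e , λ θ′ P′ e′ → best θ′ P′ (stored-θ≤ run e′) e′

lemma13 : (D : SP) (k : ℕ) (t : Table D) → Run D t →
    (Q : Profile D) → Feasible k Q →
    Σ ℕ λ θ → Σ (Profile D) λ P →
      t k θ ≡ just P ×
      (∀ θ′ P′ → t k θ′ ≡ just P′ → maxLen P ≤ maxLen P′) ×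
      toℚ (maxLen P) Q.≤ H k Q.* toℚ (maxLen Q)
lemma13 D k t run Q (refl , disjoint) =
  let R₀ , stored₀ , balanced = cell-Balanced run Q disjoint (maxLen-bounded Q)
      θ , P , stored , optimal = optimal-cell run stored₀
  in  θ , P , stored , optimal ,
      Q.≤-trans (Equivalence.to toℚ-≤ (optimal _ R₀ stored₀))
                (stored-max≤H*M run Q (maxLen-bounded Q) stored₀ balanced)
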